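{- For the complete-tournament sorting algorithm $\mathcal{A}^{\mathrm{compl\text{ - }sort}}$ on $n$ inputs, $q_n^{\mathcal{A}^{\mathrm{compl\text{ - }sort}},\mathrm{adpt}}=\binom n2$ and $\mathcal{E}_n^{\mathcal{A}^{\mathrm{compl\text{ - }sort}},\mathrm{adpt}}(2)=0$.
   Context: Model: there are $n$ items with real values (a multiset $\mathcal{X}$). A faulty comparator on two distinct inputs returns the larger if their values differ by more than $1$, and otherwise either one, possibly adversarially; an adaptive adversarial comparator may choose each outcome depending on all previous queries and outcomes. A sorting algorithm $\mathcal{A}$ outputs an ordering $(Y_1,\dots,Y_n)$ of the inputs (intended to be decreasing). Its $t$-approximation error is $\mathcal{E}_n^{\mathcal{A}}(t)=\Pr\left(\max_{i>j}(Y_i-Y_j)>t\right)$, and $\mathcal{E}_n^{\mathcal{A},\mathrm{adpt}}(t)$ is its maximum over adaptive adversarial comparators and inputs; $q_n^{\mathcal{A},\mathrm{adpt}}$ is the maximum over adaptive adversarial comparators and inputs of the expected number of comparisons. $\mathcal{A}^{\mathrm{compl\text{ - }sort}}$ compares all pairs of inputs, counts each input's wins, and outputs the inputs in decreasing order of number of wins, breaking ties randomly.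
   Formalization: The values of the $n$ input items are rational instead of real. -}

module Defs where

open import Data.Nat as ℕ using (ℕ)
open import Data.Fin using (Fin; toℕ)
open import Data.Fin.Properties using (_≟_)
open import Data.Fin.Permutation using (Permutation′; _⟨$⟩ʳ_)
open import Data.Nat.Properties using (_<?_)
open import Data.Product using (_×_; _,_; proj₁; proj₂)
open import Data.List using (List; []; _∷_; _++_; [_]; length; filter; cartesianProduct; allFin)
open import Data.Integer using (+_)
open import Data.Rational using (ℚ; _<_; _≤_; _+_; _-_; 1ℚ; _/_)
open import Relation.Binary.PropositionalEquality using (_≡_)
open import Relation.Nullary using (¬_)
open import Data.Sum using (_⊎_)

-- Input values (rationals stand in for reals).
Input : ℕ → Set
Input n = Fin n → ℚ

-- A history entry: the queried pair (i , j) and the returned winner.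
Entry : ℕ → Set
Entry n = Fin n × Fin n × Fin n

History : ℕ → Set
History n = List (Entry n)

winner : ∀ {n} → Entry n → Fin n
winner (_ , _ , w) = w

-- An adaptive (deterministic) adversarial comparator: the answer to the
-- query (i , j) may depend on the whole history of previous queries/answers.
Comparator : ℕ → Set
Comparator n = History n → Fin n → Fin n → Fin n

Valid : ∀ {n} → Input n → Comparator n → Set
Valid {n} x c = ∀ (h : History n) (i j : Fin n) → ¬ (i ≡ j) →
  (c h i j ≡ i ⊎ c h i j ≡ j) ×
  (1ℚ < x i - x j → c h i j ≡ i) ×
  (1ℚ < x j - x i → c h i j ≡ j)

allPairs : (n : ℕ) → List (Fin n × Fin n)
allPairs n = filter (λ p → toℕ (proj₁ p) <? toℕ (proj₂ p))
                    (cartesianProduct (allFin n) (allFin n))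

runQueries : ∀ {n} → Comparator n → List (Fin n × Fin n) → History n → History n
runQueries c [] h = h
runQueries c ((i , j) ∷ qs) h = runQueries c qs (h ++ [ (i , j , c h i j) ])

complSortHistory : ∀ {n} → Comparator n → History n
complSortHistory {n} c = runQueries c (allPairs n) []

complSortQueries : ∀ {n} → Comparator n → ℕ
complSortQueries c = length (complSortHistory c)

wins : ∀ {n} → Comparator n → Fin n → ℕ
wins c i = length (filter (λ e → winner e ≟ i) (complSortHistory c))

-- Possible outputs of A^{compl-sort}: orderings σ (position ↦ item) listing
-- the items in decreasing order of wins. Random tie-breaking gives each such
-- ordering positive probability, and only these.
IsComplSortOutput : ∀ {n} → Comparator n → Permutation′ n → Set
IsComplSortOutput {n} c σ =
  ∀ (k l : Fin n) → toℕ k ℕ.< toℕ l → wins c (σ ⟨$⟩ʳ l) ℕ.≤ wins c (σ ⟨$⟩ʳ k)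

-- The t-approximation-error event does NOT occur for the output σ:
-- max_{l > k} (Y_l - Y_k) ≤ t, where Y_k = x (σ k).
NoApproxError : ∀ {n} → Input n → ℚ → Permutation′ n → Set
NoApproxError {n} x t σ =
  ∀ (k l : Fin n) → toℕ k ℕ.< toℕ l → x (σ ⟨$⟩ʳ l) - x (σ ⟨$⟩ʳ k) ≤ t

two : ℚ
two = + 2 / 1

-- The tournament queries every pair i < j exactly once, whatever the comparator answers, so
-- it makes n C 2 comparisons, and the wins of an item a are counted by the list of items a
-- beat, which is duplicate-free.  If x a - x b > 2 then a beat b, and every item z beaten by
-- b has x z ≤ x b + 1 < x a - 1, so a beat z as well.  Hence b together with the items b beat
-- is contained in the items a beat, so wins b < wins a, and no ordering by decreasing wins
-- places b before a.
module Submission where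

open import Defs
open import Data.Bool using (true; false; if_then_else_)
open import Data.Empty using (⊥-elim)
open import Data.Fin using (Fin; zero; suc; toℕ)
open import Data.Fin.Properties using (_≟_; <-cmp; <⇒≢)
open import Data.Fin.Permutation using (Permutation′)
open import Data.List using (List; []; _∷_; _++_; [_]; length; map; filter; tabulate; cartesianProduct; allFin)
open import Data.List.Properties using (length-map; length-++; map-++; ++-assoc; ++-identityʳ; map-∘; map-id-local; filter-++)
open import Data.List.Membership.Propositional using (_∈_)
open import Data.List.Membership.Propositional.Properties
  using (∈-∃++; ∈-++⁻; ∈-++⁺ˡ; ∈-++⁺ʳ; ∈-map⁺; ∈-map⁻; ∈-filter⁺; ∈-filter⁻; ∈-cartesianProduct⁺; ∈-allFin)
open import Data.List.Relation.Binary.Subset.Propositional using (_⊆_)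
open import Data.List.Relation.Unary.All as All using (All; []; _∷_)
open import Data.List.Relation.Unary.All.Properties using (all-filter; ++⁺) renaming (filter⁺ to All-filter⁺)
open import Data.List.Relation.Unary.AllPairs using ([]; _∷_)
open import Data.List.Relation.Unary.Any using (here; there)
open import Data.List.Relation.Unary.Unique.Propositional using (Unique)
import Data.List.Relation.Unary.Unique.Propositional.Properties as Unique
open import Data.Nat using (ℕ; zero; suc; _+_; _≤_; _<_; z≤n; s≤s)
import Data.Nat.Properties as ℕ
open import Data.Nat.Combinatorics using (_C_; nC1≡n; nCk+nC[k+1]≡[n+1]C[k+1])
open import Algebra.Properties.Monoid.Sum ℕ.+-0-monoid using (sum-syntax; sum-cong-≗)
open import Data.Product using (_×_; _,_; proj₁; proj₂; ∃)
open import Data.Rational using (ℚ; 0ℚ; 1ℚ; _-_) renaming (_<_ to _<ℚ_)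
open import Data.Rational.Properties
  using (_<?_; <-asym; <-trans; ≮⇒≥; +-mono-<-≤; neg-antimono-≤; +-inverseʳ)
open import Data.Rational.Solver using (module +-*-Solver)
open import Data.Sum using (_⊎_; inj₁; inj₂)
open import Data.Unit using (tt)
open import Function using (_∘_; id)
open import Relation.Binary.Definitions using (tri<; tri≈; tri>)
open import Relation.Binary.PropositionalEquality using (_≡_; _≢_; refl; sym; cong; cong₂; subst; module ≡-Reasoning)
open import Relation.Nullary using (Dec; does; ¬_)
open import Relation.Nullary.Decidable using (dec-true; dec-false; toWitness)
open import Relation.Unary using (Pred; Decidable)

length-mono-⊆ : ∀ {a} {A : Set a} {xs ys : List A} → Unique xs → xs ⊆ ys → length xs ≤ length ys
length-mono-⊆ [] _ = z≤n
length-mono-⊆ {xs = x ∷ xs} (x∉xs ∷ unique) x∷xs⊆ys with ∈-∃++ (x∷xs⊆ys (here refl))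
... | us , vs , refl = begin
  suc (length xs)             ≤⟨ s≤s (length-mono-⊆ unique xs⊆us++vs) ⟩
  suc (length (us ++ vs))     ≡⟨ cong suc (length-++ us) ⟩
  suc (length us + length vs) ≡⟨ ℕ.+-suc (length us) (length vs) ⟨
  length us + length (x ∷ vs) ≡⟨ length-++ us ⟨
  length (us ++ x ∷ vs)       ∎
  where
  open ℕ.≤-Reasoning
  xs⊆us++vs : xs ⊆ us ++ vs
  xs⊆us++vs {y} y∈xs with ∈-++⁻ us (x∷xs⊆ys (there y∈xs))
  ... | inj₁ y∈us = ∈-++⁺ˡ y∈us
  ... | inj₂ (here y≡x) = ⊥-elim (All.lookup x∉xs y∈xs (sym y≡x))
  ... | inj₂ (there y∈vs) = ∈-++⁺ʳ us y∈vs

𝟙 : ∀ {p} {P : Set p} → Dec P → ℕ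
𝟙 P? = if does P? then 1 else 0

∑1≡n : ∀ n → ∑[ i < n ] 1 ≡ n
∑1≡n zero = refl
∑1≡n (suc n) = cong suc (∑1≡n n)

module _ {a p} {A : Set a} {P : Pred A p} (P? : Decidable P) where

  length-filter-map : ∀ {b} {B : Set b} (f : B → A) xs →
    length (filter P? (map f xs)) ≡ length (filter (P? ∘ f) xs)
  length-filter-map f [] = refl
  length-filter-map f (x ∷ xs) with does (P? (f x))
  ... | true = cong suc (length-filter-map f xs)
  ... | false = length-filter-map f xs

  length-filter-tabulate : ∀ {n} (f : Fin n → A) →
    length (filter P? (tabulate f)) ≡ ∑[ i < n ] 𝟙 (P? (f i))
  length-filter-tabulate {zero} f = refl
  length-filter-tabulate {suc n} f with does (P? (f zero))
  ... | true = cong suc (length-filter-tabulate (f ∘ suc))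
  ... | false = length-filter-tabulate (f ∘ suc)

length-filter-cartesianProduct : ∀ {a b p} {A : Set a} {B : Set b} {P : Pred (A × B) p} (P? : Decidable P)
  {n} (f : Fin n → A) ys →
  length (filter P? (cartesianProduct (tabulate f) ys)) ≡ ∑[ i < n ] length (filter (λ y → P? (f i , y)) ys)
length-filter-cartesianProduct P? {zero} f ys = refl
length-filter-cartesianProduct {A = A} {B} P? {suc n} f ys = begin
  length (filter P? (map (f zero ,_) ys ++ rest))
    ≡⟨ cong length (filter-++ P? (map (f zero ,_) ys) rest) ⟩
  length (filter P? (map (f zero ,_) ys) ++ filter P? rest)
    ≡⟨ length-++ (filter P? (map (f zero ,_) ys)) ⟩
  length (filter P? (map (f zero ,_) ys)) + length (filter P? rest)
    ≡⟨ cong₂ _+_ (length-filter-map P? (f zero ,_) ys) (length-filter-cartesianProduct P? (f ∘ suc) ys) ⟩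
  ∑[ i < suc n ] length (filter (λ y → P? (f i , y)) ys) ∎
  where
  open ≡-Reasoning
  rest : List (A × B)
  rest = cartesianProduct (tabulate (f ∘ suc)) ys

Ordered : ∀ {n} → Fin n × Fin n → Set
Ordered (i , j) = toℕ i < toℕ j

ordered? : ∀ {n} → Decidable (Ordered {n})
ordered? (i , j) = toℕ i ℕ.<? toℕ j

∑∑[i<j]≡nC2 : ∀ n → ∑[ i < n ] ∑[ j < n ] 𝟙 (ordered? (i , j)) ≡ n C 2
∑∑[i<j]≡nC2 zero = refl
-- The row i = 0 contributes n, and the row suc i reduces definitionally to the row i.
∑∑[i<j]≡nC2 (suc n) = begin
  ∑[ j < n ] 1 + ∑[ i < n ] ∑[ j < n ] 𝟙 (ordered? (i , j)) ≡⟨ cong₂ _+_ (∑1≡n n) (∑∑[i<j]≡nC2 n) ⟩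
  n + n C 2                                                  ≡⟨ cong (_+ n C 2) (nC1≡n n) ⟨
  n C 1 + n C 2                                              ≡⟨ nCk+nC[k+1]≡[n+1]C[k+1] n 1 ⟩
  suc n C 2                                                  ∎
  where open ≡-Reasoning

length-allPairs : ∀ n → length (allPairs n) ≡ n C 2
length-allPairs n = begin
  length (allPairs n)
    ≡⟨ length-filter-cartesianProduct ordered? {n} id (allFin n) ⟩
  ∑[ i < n ] length (filter (λ j → ordered? (i , j)) (allFin n))
    ≡⟨ sum-cong-≗ {n} (λ i → length-filter-tabulate (λ j → ordered? (i , j)) {n} id) ⟩
  ∑[ i < n ] ∑[ j < n ] 𝟙 (ordered? (i , j))
    ≡⟨ ∑∑[i<j]≡nC2 n ⟩
  n C 2 ∎
  where open ≡-Reasoning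

∈-allPairs⁺ : ∀ {n} {i j : Fin n} → Ordered (i , j) → (i , j) ∈ allPairs n
∈-allPairs⁺ {i = i} {j} = ∈-filter⁺ ordered? (∈-cartesianProduct⁺ (∈-allFin i) (∈-allFin j))

allPairs-ordered : ∀ n → All Ordered (allPairs n)
allPairs-ordered n = all-filter ordered? (cartesianProduct (allFin n) (allFin n))

allPairs-unique : ∀ n → Unique (allPairs n)
allPairs-unique n = Unique.filter⁺ _ (Unique.cartesianProduct⁺ (Unique.allFin⁺ n) (Unique.allFin⁺ n))

query : ∀ {n} → Entry n → Fin n × Fin n
query (i , j , _) = i , j

module _ {n} (c : Comparator n) where

  runQueries-queries : ∀ qs h → map query (runQueries c qs h) ≡ map query h ++ qs
  runQueries-queries [] h = sym (++-identityʳ _)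
  runQueries-queries ((i , j) ∷ qs) h = begin
    map query (runQueries c qs (h ++ [ i , j , c h i j ])) ≡⟨ runQueries-queries qs _ ⟩
    map query (h ++ [ i , j , c h i j ]) ++ qs             ≡⟨ cong (_++ qs) (map-++ query h _) ⟩
    (map query h ++ [ i , j ]) ++ qs                       ≡⟨ ++-assoc (map query h) _ qs ⟩
    map query h ++ (i , j) ∷ qs                            ∎
    where open ≡-Reasoning

  runQueries-All : ∀ {q r} {Q : Pred (Fin n × Fin n) q} {R : Pred (Entry n) r} →
    (∀ h i j → Q (i , j) → R (i , j , c h i j)) →
    ∀ {qs h} → All Q qs → All R h → All R (runQueries c qs h)
  runQueries-All step {[]} [] rs = rs
  runQueries-All step {(i , j) ∷ _} {h} (q ∷ qs) rs = runQueries-All step qs (++⁺ rs (step h i j q ∷ []))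

  history-queries : map query (complSortHistory c) ≡ allPairs n
  history-queries = runQueries-queries (allPairs n) []

  history-unique : Unique (complSortHistory c)
  history-unique = Unique.map⁻ (subst Unique (sym history-queries) (allPairs-unique n))

  ∈-history : ∀ {i j} → Ordered (i , j) → ∃ λ w → (i , j , w) ∈ complSortHistory c
  ∈-history i<j with ∈-map⁻ query (subst (_ ∈_) (sym history-queries) (∈-allPairs⁺ i<j))
  ... | (_ , _ , w) , ij∈history , refl = w , ij∈history

loser : ∀ {n} → Entry n → Fin n
loser (i , j , w) = if does (w ≟ i) then j else i

loser-left : ∀ {n} {i j : Fin n} → loser (i , j , i) ≡ j
loser-left {i = i} {j} = cong (λ b → if b then j else i) (dec-true (i ≟ i) refl)

loser-right : ∀ {n} {i j : Fin n} → i ≢ j → loser (i , j , j) ≡ i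
loser-right {i = i} {j} i≢j = cong (λ b → if b then j else i) (dec-false (j ≟ i) (i≢j ∘ sym))

match : ∀ {n} → Fin n → Fin n → Entry n
match w l = if does (ordered? (w , l)) then (w , l , w) else (l , w , w)

_≫_ : ℚ → ℚ → Set
p ≫ q = 1ℚ <ℚ p - q

≫-irrefl : ∀ p → ¬ p ≫ p
≫-irrefl p p≫p = <-asym (subst (1ℚ <ℚ_) (+-inverseʳ p) p≫p) (toWitness {a? = 0ℚ <? 1ℚ} tt)

Consistent : ∀ {n} → Input n → Entry n → Set
Consistent x (i , j , w) = Ordered (i , j) × (w ≡ i ⊎ w ≡ j) × (x i ≫ x j → w ≡ i) × (x j ≫ x i → w ≡ j)

module _ {n} (x : Input n) where

  loser≢winner : ∀ {e} → Consistent x e → loser e ≢ winner e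
  loser≢winner {i , j , _} (i<j , inj₁ refl , _) rewrite loser-left {i = i} {j} = <⇒≢ i<j ∘ sym
  loser≢winner {i , j , _} (i<j , inj₂ refl , _) rewrite loser-right (<⇒≢ i<j) = <⇒≢ i<j

  loser≯winner : ∀ {e} → Consistent x e → ¬ x (loser e) ≫ x (winner e)
  loser≯winner {i , j , _} (i<j , inj₁ refl , _ , j≫i⇒j) rewrite loser-left {i = i} {j} = <⇒≢ i<j ∘ j≫i⇒j
  loser≯winner {i , j , _} (i<j , inj₂ refl , i≫j⇒i , _) rewrite loser-right (<⇒≢ i<j) = <⇒≢ i<j ∘ sym ∘ i≫j⇒i

  match-winner-loser : ∀ {e} → Consistent x e → match (winner e) (loser e) ≡ e
  match-winner-loser {i , j , _} (i<j , inj₁ refl , _) rewrite loser-left {i = i} {j} =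
    cong (λ b → if b then (i , j , i) else (j , i , i)) (dec-true (ordered? (i , j)) i<j)
  match-winner-loser {i , j , _} (i<j , inj₂ refl , _) rewrite loser-right (<⇒≢ i<j) =
    cong (λ b → if b then (j , i , j) else (i , j , j)) (dec-false (ordered? (j , i)) (ℕ.<⇒≯ i<j))

1<two : 1ℚ <ℚ two
1<two = toWitness {a? = 1ℚ <? two} tt

gap-split : ∀ {p q r} → two <ℚ p - r → ¬ q ≫ r → p ≫ q
gap-split {p} {q} {r} two<p-r q≯r =
  subst (1ℚ <ℚ_) (cancel p q r) (+-mono-<-≤ two<p-r (neg-antimono-≤ (≮⇒≥ q≯r)))
  where
  open +-*-Solver
  cancel : ∀ p q r → (p - r) - (q - r) ≡ p - q
  cancel = solve 3 (λ p q r → (p :- r) :- (q :- r) := p :- q) refl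

victories : ∀ {n} → Comparator n → Fin n → History n
victories c a = filter (λ e → winner e ≟ a) (complSortHistory c)

beaten : ∀ {n} → Comparator n → Fin n → List (Fin n)
beaten c a = map loser (victories c a)

wins≡length-beaten : ∀ {n} (c : Comparator n) a → wins c a ≡ length (beaten c a)
wins≡length-beaten c a = sym (length-map loser (victories c a))

loser∈beaten : ∀ {n} (c : Comparator n) {e} → e ∈ complSortHistory c → loser e ∈ beaten c (winner e)
loser∈beaten c e∈ = ∈-map⁺ loser (∈-filter⁺ _ e∈ refl)

module _ {n} (x : Input n) (c : Comparator n) (valid : Valid x c) where

  history-consistent : All (Consistent x) (complSortHistory c)
  history-consistent = runQueries-All c (λ h i j i<j → i<j , valid h i j (<⇒≢ i<j)) (allPairs-ordered n) []

  ∈-beaten⁻ : ∀ {a z} → z ∈ beaten c a → z ≢ a × ¬ x z ≫ x a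
  ∈-beaten⁻ {a} z∈ with ∈-map⁻ loser z∈
  ... | e , e∈ , refl with ∈-filter⁻ (λ e → winner e ≟ a) e∈
  ...   | e∈history , refl = loser≢winner x ok , loser≯winner x ok
    where ok = All.lookup history-consistent e∈history

  ∈-beaten⁺ : ∀ {a z} → x a ≫ x z → z ∈ beaten c a
  ∈-beaten⁺ {a} {z} a≫z with <-cmp a z
  ... | tri≈ _ refl _ = ⊥-elim (≫-irrefl (x a) a≫z)
  ... | tri< a<z _ _ with ∈-history c a<z
  ...   | w , e∈ with All.lookup history-consistent e∈
  ...     | _ , _ , a≫z⇒w≡a , _ with a≫z⇒w≡a a≫z
  ...       | refl = subst (_∈ beaten c a) (loser-left {i = a}) (loser∈beaten c e∈)
  ∈-beaten⁺ {a} {z} a≫z | tri> _ _ z<a with ∈-history c z<a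
  ...   | w , e∈ with All.lookup history-consistent e∈
  ...     | _ , _ , _ , a≫z⇒w≡a with a≫z⇒w≡a a≫z
  ...       | refl = subst (_∈ beaten c a) (loser-right (<⇒≢ z<a)) (loser∈beaten c e∈)

  -- loser is injective on the victories of a, because match a is a left inverse there.
  beaten-unique : ∀ a → Unique (beaten c a)
  beaten-unique a = Unique.map⁻ (subst Unique (sym match∘beaten) (Unique.filter⁺ won? (history-unique c)))
    where
    won? : Decidable (λ (e : Entry n) → winner e ≡ a)
    won? e = winner e ≟ a
    reconstruct : ∀ {e} → Consistent x e × winner e ≡ a → match a (loser e) ≡ e
    reconstruct (ok , refl) = match-winner-loser x ok
    match∘beaten : map (match a) (beaten c a) ≡ victories c a
    match∘beaten = begin
      map (match a) (map loser (victories c a)) ≡⟨ map-∘ (victories c a) ⟨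
      map (match a ∘ loser) (victories c a)
        ≡⟨ map-id-local (All.zipWith reconstruct
             (All-filter⁺ won? history-consistent , all-filter won? (complSortHistory c))) ⟩
      victories c a                             ∎
      where open ≡-Reasoning

  wins-gap : ∀ {a b} → two <ℚ x a - x b → suc (wins c b) ≤ wins c a
  wins-gap {a} {b} two<a-b = begin
    suc (wins c b)          ≡⟨ cong suc (wins≡length-beaten c b) ⟩
    length (b ∷ beaten c b) ≤⟨ length-mono-⊆ (b∉beaten ∷ beaten-unique b) b∷beaten⊆beaten ⟩
    length (beaten c a)     ≡⟨ wins≡length-beaten c a ⟨
    wins c a                ∎
    where
    open ℕ.≤-Reasoning
    b∉beaten : All (b ≢_) (beaten c b)
    b∉beaten = All.tabulate (λ z∈ → proj₁ (∈-beaten⁻ z∈) ∘ sym)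
    b∷beaten⊆beaten : b ∷ beaten c b ⊆ beaten c a
    b∷beaten⊆beaten (here refl) = ∈-beaten⁺ (<-trans 1<two two<a-b)
    b∷beaten⊆beaten {z} (there z∈) = ∈-beaten⁺ (gap-split {x a} {x z} {x b} two<a-b (proj₂ (∈-beaten⁻ z∈)))

complSortQueries≡nC2 : ∀ {n} (c : Comparator n) → complSortQueries c ≡ n C 2
complSortQueries≡nC2 {n} c = begin
  length (complSortHistory c)              ≡⟨ length-map query (complSortHistory c) ⟨
  length (map query (complSortHistory c))  ≡⟨ cong length (history-queries c) ⟩
  length (allPairs n)                      ≡⟨ length-allPairs n ⟩
  n C 2                                    ∎
  where open ≡-Reasoning

lemma10 : (n : ℕ) →
    ((x : Input n) (c : Comparator n) → Valid x c → complSortQueries c ≡ n C 2) ×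
    ((x : Input n) (c : Comparator n) → Valid x c →
      (σ : Permutation′ n) → IsComplSortOutput c σ → NoApproxError x two σ)
lemma10 n = (λ _ c _ → complSortQueries≡nC2 c) , noApproxError
  where
  noApproxError : (x : Input n) (c : Comparator n) → Valid x c →
    (σ : Permutation′ n) → IsComplSortOutput c σ → NoApproxError x two σ
  noApproxError x c valid σ sorted k l k<l =
    ≮⇒≥ (λ two<gap → ℕ.<⇒≱ (wins-gap x c valid two<gap) (sorted k l k<l))
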